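{- Let $\alpha\in(0,1)$, $\Phi(z)=1-(1-z)^\alpha$, and for $n\ge1$ let $K_n$ be a random variable on $\{1,\dots,n\}$ with $\mathbf{P}(K_n=k)=\mathcal{C}_{n,k}/[\alpha]_n$, where $\mathcal{C}_{n,k}=n![z^n]\Phi(z)^k$ (the number of trees in a random size-$n$ forest of distinguishable Sibuya trees). Then for all $n\ge1$ and $k=1,\dots,n+1$, $$\mathbf{P}(K_{n+1}=k)=\frac{k\alpha}{\alpha+n}\mathbf{P}(K_n=k-1)+\frac{n-k\alpha}{\alpha+n}\mathbf{P}(K_n=k),$$ with $K_1=1$ (and $\mathbf{P}(K_n=0)=0$, $\mathbf{P}(K_n=n+1)=0$). Consequently the laws of $(K_n)_{n\ge1}$ are the one-dimensional marginals of the pure-birth Markov chain on $\{1,2,\dots\}$ with $K_1=1$ and transition probabilities $\mathbf{P}(K_{n+1}=k+1\mid K_n=k)=\frac{(k+1)\alpha}{\alpha+n}$, $\mathbf{P}(K_{n+1}=k\mid K_n=k)=\frac{n-k\alpha}{\alpha+n}$.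
   Context: $[z^n]f(z)$ denotes the coefficient of $z^n$ in the power series of $f$; $[a]_n=a(a+1)\cdots(a+n-1)$ is the rising factorial.
   Formalization: The parameter α ranges over the rationals in $(0,1)$. -}

module Defs where

open import Data.Nat as ℕ using (ℕ; zero; suc)
open import Data.Nat using (_!)
open import Data.Integer using (+_)
open import Data.Rational using (ℚ; 0ℚ; 1ℚ; _+_; _*_; _-_; -_; _÷_; _≟_; ≢-nonZero; _/_)
open import Relation.Nullary using (yes; no)

ι : ℕ → ℚ
ι n = (+ n) / 1

-- division; the divisor is nonzero in every use below (α > 0),
-- the case 0 only makes the function total
_÷′_ : ℚ → ℚ → ℚ
p ÷′ q with q ≟ 0ℚ
... | yes _ = 0ℚ
... | no q≢0 = _÷_ p q {{≢-nonZero q≢0}}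

-- formal power series over ℚ, as coefficient sequences: f m = [z^m] f
Series : Set
Series = ℕ → ℚ

conv : Series → Series → ℕ → ℕ → ℚ
conv f g n zero    = f 0 * g n
conv f g n (suc i) = conv f g n i + f (suc i) * g (n ℕ.∸ suc i)

_⋆_ : Series → Series → Series
(f ⋆ g) n = conv f g n n

oneS : Series
oneS zero    = 1ℚ
oneS (suc _) = 0ℚ

_^S_ : Series → ℕ → Series
f ^S zero  = oneS
f ^S suc k = f ⋆ (f ^S k)

binomQ : ℚ → ℕ → ℚ
binomQ a zero    = 1ℚ
binomQ a (suc m) = (binomQ a m * (a - ι m)) ÷′ ι (suc m)

-- (1 - z)^a = Σ_m binom(a,m) (-1)^m z^m
signPow : ℕ → ℚ → ℚ
signPow zero    x = x
signPow (suc m) x = - signPow m x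

oneMinusZPow : ℚ → Series
oneMinusZPow a m = signPow m (binomQ a m)

Φ : ℚ → Series
Φ α m = oneS m - oneMinusZPow α m

rising : ℚ → ℕ → ℚ
rising a zero    = 1ℚ
rising a (suc n) = rising a n * (a + ι n)

𝒞 : ℚ → ℕ → ℕ → ℚ
𝒞 α n k = ι (n !) * ((Φ α ^S k) n)

probK : ℚ → ℕ → ℕ → ℚ
probK α n k = 𝒞 α n k ÷′ rising α n

upProb : ℚ → ℕ → ℕ → ℚ
upProb α n k = (ι (suc k) * α) ÷′ (α + ι n)

stayProb : ℚ → ℕ → ℕ → ℚ
stayProb α n k = (ι n - ι k * α) ÷′ (α + ι n)

-- chainLaw α n k = P(K_n = k) for the chain, n ≥ 1 (time 1: K_1 = 1)
-- computed by the forward (Chapman–Kolmogorov) equation: a state k at time n+1 is reached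
-- either from k-1 by a birth or from k by staying.
chainLaw : ℚ → ℕ → ℕ → ℚ
chainLaw α zero    k = 0ℚ   -- unused (time 0 is not part of the chain)
chainLaw α (suc zero) zero = 0ℚ
chainLaw α (suc zero) (suc zero) = 1ℚ
chainLaw α (suc zero) (suc (suc _)) = 0ℚ
chainLaw α (suc (suc m)) zero = stayProb α (suc m) 0 * chainLaw α (suc m) 0
chainLaw α (suc (suc m)) (suc k) =
  upProb α (suc m) k * chainLaw α (suc m) k + stayProb α (suc m) (suc k) * chainLaw α (suc m) (suc k)

{-# OPTIONS --safe #-}
module Submission where

-- Write θ = z d/dz for the Euler operator and δ = (1 − z) θ.  The generalized
-- binomial series satisfies (1 − z) Φ′ = α (1 − Φ), i.e. δ Φ = α z (1 − Φ), and
-- δ is a derivation of the Cauchy product, so by induction on k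
--   δ (Φ^(k+1)) = (k + 1) α z (Φ^k − Φ^(k+1)).
-- Comparing coefficients of z^(n+1) and multiplying by n! gives
--   𝒞(n+1, k+1) = (k + 1) α 𝒞(n, k) + (n − (k + 1) α) 𝒞(n, k+1),
-- and dividing by [α]_(n+1) = [α]_n (α + n) turns this into the forward equation
-- of the pure-birth chain.

open import Defs
open import Data.Nat as ℕ using (ℕ; zero; suc; z≤n; s≤s; _!)
import Data.Nat.Properties as ℕP
open import Data.Integer as ℤ using (+_)
import Data.Integer.Properties as ℤP
open import Data.Rational using (ℚ; 0ℚ; 1ℚ; _<_; _≤_; _+_; _*_; _-_; -_; 1/_; _≟_; NonZero; ≢-nonZero; toℚᵘ)
import Data.Rational.Properties as ℚP
open import Data.Rational.Solver using (module +-*-Solver)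
open +-*-Solver
open import Data.Rational.Unnormalised as ℚᵘ using (mkℚᵘ; *≡*)
import Data.Rational.Unnormalised.Properties as ℚᵘP
open import Data.Product using (_×_; _,_)
open import Data.Empty using (⊥-elim)
open import Relation.Nullary using (yes; no)
open import Relation.Binary.PropositionalEquality
import Relation.Binary.Reasoning.Setoid as SetoidReasoning

-- ι n computes to fromℚᵘ (mkℚᵘ (+ n) 0); on ℚᵘ, + and * involve no normalisation.
toℚᵘ-ι : ∀ n → toℚᵘ (ι n) ℚᵘ.≃ mkℚᵘ (+ n) 0
toℚᵘ-ι n = ℚP.toℚᵘ-fromℚᵘ (mkℚᵘ (+ n) 0)

ι-+ : ∀ m n → ι (m ℕ.+ n) ≡ ι m + ι n
ι-+ m n = ℚP.toℚᵘ-injective (begin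
    toℚᵘ (ι (m ℕ.+ n))              ≈⟨ toℚᵘ-ι (m ℕ.+ n) ⟩
    mkℚᵘ (+ (m ℕ.+ n)) 0            ≈⟨ *≡* (cong (ℤ._* + 1) +[m+n]≡+m*1++n*1) ⟩
    mkℚᵘ (+ m) 0 ℚᵘ.+ mkℚᵘ (+ n) 0  ≈⟨ ℚᵘP.+-cong (toℚᵘ-ι m) (toℚᵘ-ι n) ⟨
    toℚᵘ (ι m) ℚᵘ.+ toℚᵘ (ι n)      ≈⟨ ℚP.toℚᵘ-homo-+ (ι m) (ι n) ⟨
    toℚᵘ (ι m + ι n)                ∎)
  where
  open ℚᵘP.≃-Reasoning
  +[m+n]≡+m*1++n*1 : + (m ℕ.+ n) ≡ + m ℤ.* + 1 ℤ.+ + n ℤ.* + 1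
  +[m+n]≡+m*1++n*1 = trans (ℤP.pos-+ m n) (sym (cong₂ ℤ._+_ (ℤP.*-identityʳ (+ m)) (ℤP.*-identityʳ (+ n))))

ι-* : ∀ m n → ι (m ℕ.* n) ≡ ι m * ι n
ι-* m n = ℚP.toℚᵘ-injective (begin
    toℚᵘ (ι (m ℕ.* n))              ≈⟨ toℚᵘ-ι (m ℕ.* n) ⟩
    mkℚᵘ (+ (m ℕ.* n)) 0            ≈⟨ *≡* (cong (ℤ._* + 1) (ℤP.pos-* m n)) ⟩
    mkℚᵘ (+ m) 0 ℚᵘ.* mkℚᵘ (+ n) 0  ≈⟨ ℚᵘP.*-cong (toℚᵘ-ι m) (toℚᵘ-ι n) ⟨
    toℚᵘ (ι m) ℚᵘ.* toℚᵘ (ι n)      ≈⟨ ℚP.toℚᵘ-homo-* (ι m) (ι n) ⟨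
    toℚᵘ (ι m * ι n)                ∎)
  where open ℚᵘP.≃-Reasoning

ι-suc : ∀ n → ι (suc n) ≡ 1ℚ + ι n
ι-suc = ι-+ 1

ι-nonNeg : ∀ n → 0ℚ ≤ ι n
ι-nonNeg n = ℚP.nonNegative⁻¹ (ι n) {{ℚP.normalize-nonNeg n 1}}

ι-suc≢0 : ∀ n → ι (suc n) ≢ 0ℚ
ι-suc≢0 n eq = ℚP.<⇒≢ (ℚP.positive⁻¹ (ι (suc n)) {{ℚP.normalize-pos (suc n) 1}}) (sym eq)

q*[p÷′q]≡p : ∀ p q → q ≢ 0ℚ → q * (p ÷′ q) ≡ p
q*[p÷′q]≡p p q q≢0 with q ≟ 0ℚ
... | yes q≡0 = ⊥-elim (q≢0 q≡0)
... | no q≢0′ = begin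
  q * (p * 1/ q)  ≡⟨ solve 3 (λ a b c → a :* (b :* c) := b :* (a :* c)) refl q p (1/ q) ⟩
  p * (q * 1/ q)  ≡⟨ cong (p *_) (ℚP.*-inverseʳ q) ⟩
  p * 1ℚ          ≡⟨ ℚP.*-identityʳ p ⟩
  p               ∎
  where
  open ≡-Reasoning
  instance
    _ : NonZero q
    _ = ≢-nonZero q≢0′

q*x≡p⇒p÷′q≡x : ∀ p q x → q ≢ 0ℚ → q * x ≡ p → p ÷′ q ≡ x
q*x≡p⇒p÷′q≡x p q x q≢0 q*x≡p with q ≟ 0ℚ
... | yes q≡0 = ⊥-elim (q≢0 q≡0)
... | no q≢0′ = begin
  p * 1/ q        ≡⟨ cong (_* 1/ q) q*x≡p ⟨
  q * x * 1/ q    ≡⟨ solve 3 (λ a b c → a :* b :* c := b :* (a :* c)) refl q x (1/ q) ⟩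
  x * (q * 1/ q)  ≡⟨ cong (x *_) (ℚP.*-inverseʳ q) ⟩
  x * 1ℚ          ≡⟨ ℚP.*-identityʳ x ⟩
  x               ∎
  where
  open ≡-Reasoning
  instance
    _ : NonZero q
    _ = ≢-nonZero q≢0′

0÷′q≡0 : ∀ q → 0ℚ ÷′ q ≡ 0ℚ
0÷′q≡0 q with q ≟ 0ℚ
... | yes _   = refl
... | no q≢0 = ℚP.*-zeroˡ ((1/ q) {{≢-nonZero q≢0}})

*-≢0 : ∀ p q → p ≢ 0ℚ → q ≢ 0ℚ → p * q ≢ 0ℚ
*-≢0 p q p≢0 q≢0 p*q≡0 = p≢0 (begin
  p               ≡⟨ q*x≡p⇒p÷′q≡x (p * q) q p q≢0 (ℚP.*-comm q p) ⟨
  (p * q) ÷′ q    ≡⟨ cong (_÷′ q) p*q≡0 ⟩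
  0ℚ ÷′ q         ≡⟨ 0÷′q≡0 q ⟩
  0ℚ              ∎)
  where open ≡-Reasoning

÷′-distrib-*+* : ∀ a b x y r d → r ≢ 0ℚ → d ≢ 0ℚ →
  (a * x + b * y) ÷′ (r * d) ≡ (a ÷′ d) * (x ÷′ r) + (b ÷′ d) * (y ÷′ r)
÷′-distrib-*+* a b x y r d r≢0 d≢0 = q*x≡p⇒p÷′q≡x _ _ _ (*-≢0 r d r≢0 d≢0) (begin
  r * d * ((a ÷′ d) * (x ÷′ r) + (b ÷′ d) * (y ÷′ r))
    ≡⟨ solve 6 (λ r d a′ x′ b′ y′ → r :* d :* (a′ :* x′ :+ b′ :* y′) := d :* a′ :* (r :* x′) :+ d :* b′ :* (r :* y′))
             refl r d (a ÷′ d) (x ÷′ r) (b ÷′ d) (y ÷′ r) ⟩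
  d * (a ÷′ d) * (r * (x ÷′ r)) + d * (b ÷′ d) * (r * (y ÷′ r))
    ≡⟨ cong₂ _+_ (cong₂ _*_ (q*[p÷′q]≡p a d d≢0) (q*[p÷′q]≡p x r r≢0))
                 (cong₂ _*_ (q*[p÷′q]≡p b d d≢0) (q*[p÷′q]≡p y r r≢0)) ⟩
  a * x + b * y ∎)
  where open ≡-Reasoning

sum≤ : (ℕ → ℚ) → ℕ → ℚ
sum≤ h zero    = h 0
sum≤ h (suc i) = sum≤ h i + h (suc i)

sum≤-cong : ∀ {h h′} i → (∀ j → j ℕ.≤ i → h j ≡ h′ j) → sum≤ h i ≡ sum≤ h′ i
sum≤-cong zero    h≡h′ = h≡h′ 0 z≤n
sum≤-cong (suc i) h≡h′ =
  cong₂ _+_ (sum≤-cong i (λ j j≤i → h≡h′ j (ℕP.m≤n⇒m≤1+n j≤i))) (h≡h′ (suc i) ℕP.≤-refl)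

sum≤-distrib-+ : ∀ h h′ i → sum≤ (λ j → h j + h′ j) i ≡ sum≤ h i + sum≤ h′ i
sum≤-distrib-+ h h′ zero    = refl
sum≤-distrib-+ h h′ (suc i) = trans (cong (_+ (h (suc i) + h′ (suc i))) (sum≤-distrib-+ h h′ i))
  (solve 4 (λ a b c d → a :+ b :+ (c :+ d) := a :+ c :+ (b :+ d)) refl
           (sum≤ h i) (sum≤ h′ i) (h (suc i)) (h′ (suc i)))

sum≤-distrib-minus : ∀ h h′ i → sum≤ (λ j → h j - h′ j) i ≡ sum≤ h i - sum≤ h′ i
sum≤-distrib-minus h h′ zero    = refl
sum≤-distrib-minus h h′ (suc i) = trans (cong (_+ (h (suc i) - h′ (suc i))) (sum≤-distrib-minus h h′ i))
  (solve 4 (λ a b c d → a :- b :+ (c :- d) := a :+ c :- (b :+ d)) refl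
           (sum≤ h i) (sum≤ h′ i) (h (suc i)) (h′ (suc i)))

sum≤-*ˡ : ∀ c h i → sum≤ (λ j → c * h j) i ≡ c * sum≤ h i
sum≤-*ˡ c h zero    = refl
sum≤-*ˡ c h (suc i) =
  trans (cong (_+ c * h (suc i)) (sum≤-*ˡ c h i)) (sym (ℚP.*-distribˡ-+ c (sum≤ h i) (h (suc i))))

sum≤-0 : ∀ h i → (∀ j → h j ≡ 0ℚ) → sum≤ h i ≡ 0ℚ
sum≤-0 h zero    h≡0 = h≡0 0
sum≤-0 h (suc i) h≡0 = cong₂ _+_ (sum≤-0 h i h≡0) (h≡0 (suc i))

sum≤-suc : ∀ h i → sum≤ h (suc i) ≡ h 0 + sum≤ (λ j → h (suc j)) i
sum≤-suc h zero    = refl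
sum≤-suc h (suc i) =
  trans (cong (_+ h (suc (suc i))) (sum≤-suc h i)) (ℚP.+-assoc (h 0) _ (h (suc (suc i))))

convTerm : Series → Series → ℕ → ℕ → ℚ
convTerm f g n j = f j * g (n ℕ.∸ j)

⋆≡sum≤ : ∀ f g n → (f ⋆ g) n ≡ sum≤ (convTerm f g n) n
⋆≡sum≤ f g n = conv≡sum≤ n
  where
  conv≡sum≤ : ∀ i → conv f g n i ≡ sum≤ (convTerm f g n) i
  conv≡sum≤ zero    = refl
  conv≡sum≤ (suc i) = cong (_+ convTerm f g n (suc i)) (conv≡sum≤ i)

infixl 6 _⊕_ _⊖_
infixl 7 _⊙_
infixr 25 z·_

_⊕_ : Series → Series → Series
(f ⊕ g) n = f n + g n

_⊖_ : Series → Series → Series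
(f ⊖ g) n = f n - g n

_⊙_ : ℚ → Series → Series
(c ⊙ f) n = c * f n

zeroS : Series
zeroS _ = 0ℚ

θ : Series → Series
θ f n = ι n * f n

z·_ : Series → Series
(z· f) zero    = 0ℚ
(z· f) (suc n) = f n

δ : Series → Series
δ f = θ f ⊖ z· θ f

module ≗-Reasoning = SetoidReasoning (ℕ →-setoid ℚ)

⊕-cong : ∀ {f f′ g g′} → f ≗ f′ → g ≗ g′ → f ⊕ g ≗ f′ ⊕ g′
⊕-cong f≗f′ g≗g′ n = cong₂ _+_ (f≗f′ n) (g≗g′ n)

⊖-cong : ∀ {f f′ g g′} → f ≗ f′ → g ≗ g′ → f ⊖ g ≗ f′ ⊖ g′
⊖-cong f≗f′ g≗g′ n = cong₂ _-_ (f≗f′ n) (g≗g′ n)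

⊙-cong : ∀ c {f g} → f ≗ g → c ⊙ f ≗ c ⊙ g
⊙-cong c f≗g n = cong (c *_) (f≗g n)

z·-cong : ∀ {f g} → f ≗ g → z· f ≗ z· g
z·-cong f≗g zero    = refl
z·-cong f≗g (suc n) = f≗g n

⋆-cong : ∀ {f f′ g g′} → f ≗ f′ → g ≗ g′ → f ⋆ g ≗ f′ ⋆ g′
⋆-cong {f} {f′} {g} {g′} f≗f′ g≗g′ n = begin
  (f ⋆ g) n                     ≡⟨ ⋆≡sum≤ f g n ⟩
  sum≤ (convTerm f g n) n       ≡⟨ sum≤-cong n (λ j _ → cong₂ _*_ (f≗f′ j) (g≗g′ (n ℕ.∸ j))) ⟩
  sum≤ (convTerm f′ g′ n) n     ≡⟨ ⋆≡sum≤ f′ g′ n ⟨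
  (f′ ⋆ g′) n                   ∎
  where open ≡-Reasoning

⋆-distribʳ-⊖ : ∀ f f′ g → (f ⊖ f′) ⋆ g ≗ f ⋆ g ⊖ f′ ⋆ g
⋆-distribʳ-⊖ f f′ g n = begin
  ((f ⊖ f′) ⋆ g) n                                       ≡⟨ ⋆≡sum≤ (f ⊖ f′) g n ⟩
  sum≤ (convTerm (f ⊖ f′) g n) n                         ≡⟨ sum≤-cong n (λ j _ → distrib (f j) (f′ j) (g (n ℕ.∸ j))) ⟩
  sum≤ (λ j → convTerm f g n j - convTerm f′ g n j) n    ≡⟨ sum≤-distrib-minus _ _ n ⟩
  sum≤ (convTerm f g n) n - sum≤ (convTerm f′ g n) n     ≡⟨ cong₂ _-_ (⋆≡sum≤ f g n) (⋆≡sum≤ f′ g n) ⟨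
  (f ⋆ g) n - (f′ ⋆ g) n                                 ∎
  where
  open ≡-Reasoning
  distrib : ∀ a b c → (a - b) * c ≡ a * c - b * c
  distrib = solve 3 (λ a b c → (a :- b) :* c := a :* c :- b :* c) refl

⋆-distribˡ-⊖ : ∀ f g g′ → f ⋆ (g ⊖ g′) ≗ f ⋆ g ⊖ f ⋆ g′
⋆-distribˡ-⊖ f g g′ n = begin
  (f ⋆ (g ⊖ g′)) n                                       ≡⟨ ⋆≡sum≤ f (g ⊖ g′) n ⟩
  sum≤ (convTerm f (g ⊖ g′) n) n                         ≡⟨ sum≤-cong n (λ j _ → distrib (f j) (g (n ℕ.∸ j)) (g′ (n ℕ.∸ j))) ⟩
  sum≤ (λ j → convTerm f g n j - convTerm f g′ n j) n    ≡⟨ sum≤-distrib-minus _ _ n ⟩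
  sum≤ (convTerm f g n) n - sum≤ (convTerm f g′ n) n     ≡⟨ cong₂ _-_ (⋆≡sum≤ f g n) (⋆≡sum≤ f g′ n) ⟨
  (f ⋆ g) n - (f ⋆ g′) n                                 ∎
  where
  open ≡-Reasoning
  distrib : ∀ a b c → a * (b - c) ≡ a * b - a * c
  distrib = solve 3 (λ a b c → a :* (b :- c) := a :* b :- a :* c) refl

⊙-⋆ : ∀ c f g → (c ⊙ f) ⋆ g ≗ c ⊙ (f ⋆ g)
⊙-⋆ c f g n = begin
  ((c ⊙ f) ⋆ g) n                          ≡⟨ ⋆≡sum≤ (c ⊙ f) g n ⟩
  sum≤ (convTerm (c ⊙ f) g n) n            ≡⟨ sum≤-cong n (λ j _ → ℚP.*-assoc c (f j) (g (n ℕ.∸ j))) ⟩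
  sum≤ (λ j → c * convTerm f g n j) n      ≡⟨ sum≤-*ˡ c _ n ⟩
  c * sum≤ (convTerm f g n) n              ≡⟨ cong (c *_) (⋆≡sum≤ f g n) ⟨
  c * (f ⋆ g) n                            ∎
  where open ≡-Reasoning

⋆-⊙ : ∀ c f g → f ⋆ (c ⊙ g) ≗ c ⊙ (f ⋆ g)
⋆-⊙ c f g n = begin
  (f ⋆ (c ⊙ g)) n                          ≡⟨ ⋆≡sum≤ f (c ⊙ g) n ⟩
  sum≤ (convTerm f (c ⊙ g) n) n            ≡⟨ sum≤-cong n (λ j _ → swap (f j) c (g (n ℕ.∸ j))) ⟩
  sum≤ (λ j → c * convTerm f g n j) n      ≡⟨ sum≤-*ˡ c _ n ⟩
  c * sum≤ (convTerm f g n) n              ≡⟨ cong (c *_) (⋆≡sum≤ f g n) ⟨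
  c * (f ⋆ g) n                            ∎
  where
  open ≡-Reasoning
  swap : ∀ a b d → a * (b * d) ≡ b * (a * d)
  swap = solve 3 (λ a b d → a :* (b :* d) := b :* (a :* d)) refl

⋆-zeroʳ : ∀ f → f ⋆ zeroS ≗ zeroS
⋆-zeroʳ f n = trans (⋆≡sum≤ f zeroS n) (sum≤-0 _ n (λ j → ℚP.*-zeroʳ (f j)))

⋆-identityˡ : ∀ g → oneS ⋆ g ≗ g
⋆-identityˡ g n = trans (⋆≡sum≤ oneS g n) (only-first-term n)
  where
  only-first-term : ∀ i → sum≤ (convTerm oneS g n) i ≡ g n
  only-first-term zero    = ℚP.*-identityˡ (g n)
  only-first-term (suc i) =
    trans (cong₂ _+_ (only-first-term i) (ℚP.*-zeroˡ (g (n ℕ.∸ suc i)))) (ℚP.+-identityʳ (g n))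

z·-⋆ : ∀ f g → (z· f) ⋆ g ≗ z· (f ⋆ g)
z·-⋆ f g zero    = ℚP.*-zeroˡ (g 0)
z·-⋆ f g (suc n) = begin
  ((z· f) ⋆ g) (suc n)                    ≡⟨ ⋆≡sum≤ (z· f) g (suc n) ⟩
  sum≤ (convTerm (z· f) g (suc n)) (suc n) ≡⟨ sum≤-suc _ n ⟩
  0ℚ * g (suc n) + sum≤ (convTerm f g n) n ≡⟨ cong₂ _+_ (ℚP.*-zeroˡ (g (suc n))) (sym (⋆≡sum≤ f g n)) ⟩
  0ℚ + (f ⋆ g) n                          ≡⟨ ℚP.+-identityˡ _ ⟩
  (f ⋆ g) n                               ∎
  where open ≡-Reasoning

⋆-z· : ∀ f g → f ⋆ (z· g) ≗ z· (f ⋆ g)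
⋆-z· f g zero    = ℚP.*-zeroʳ (f 0)
⋆-z· f g (suc n) = begin
  (f ⋆ (z· g)) (suc n)                                             ≡⟨ ⋆≡sum≤ f (z· g) (suc n) ⟩
  sum≤ (convTerm f (z· g) (suc n)) n + convTerm f (z· g) (suc n) (suc n)
                                                                   ≡⟨ cong₂ _+_ (sum≤-cong n shift) last-term ⟩
  sum≤ (convTerm f g n) n + 0ℚ                                     ≡⟨ ℚP.+-identityʳ _ ⟩
  sum≤ (convTerm f g n) n                                          ≡⟨ ⋆≡sum≤ f g n ⟨
  (f ⋆ g) n                                                        ∎
  where
  open ≡-Reasoning
  shift : ∀ j → j ℕ.≤ n → convTerm f (z· g) (suc n) j ≡ convTerm f g n j
  shift j j≤n = cong (λ i → f j * (z· g) i) (ℕP.+-∸-assoc 1 j≤n)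
  last-term : convTerm f (z· g) (suc n) (suc n) ≡ 0ℚ
  last-term = trans (cong (λ i → f (suc n) * (z· g) i) (ℕP.n∸n≡0 n)) (ℚP.*-zeroʳ (f (suc n)))

z·-⊕ : ∀ f g → z· (f ⊕ g) ≗ z· f ⊕ z· g
z·-⊕ f g zero    = refl
z·-⊕ f g (suc n) = refl

θ-⋆ : ∀ f g → θ (f ⋆ g) ≗ θ f ⋆ g ⊕ f ⋆ θ g
θ-⋆ f g n = begin
  ι n * (f ⋆ g) n                                                ≡⟨ cong (ι n *_) (⋆≡sum≤ f g n) ⟩
  ι n * sum≤ (convTerm f g n) n                                  ≡⟨ sum≤-*ˡ (ι n) _ n ⟨
  sum≤ (λ j → ι n * convTerm f g n j) n                          ≡⟨ sum≤-cong n split ⟩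
  sum≤ (λ j → convTerm (θ f) g n j + convTerm f (θ g) n j) n     ≡⟨ sum≤-distrib-+ _ _ n ⟩
  sum≤ (convTerm (θ f) g n) n + sum≤ (convTerm f (θ g) n) n      ≡⟨ cong₂ _+_ (⋆≡sum≤ (θ f) g n) (⋆≡sum≤ f (θ g) n) ⟨
  (θ f ⋆ g) n + (f ⋆ θ g) n                                      ∎
  where
  open ≡-Reasoning
  split : ∀ j → j ℕ.≤ n → ι n * convTerm f g n j ≡ convTerm (θ f) g n j + convTerm f (θ g) n j
  split j j≤n = begin
    ι n * (f j * g (n ℕ.∸ j))                      ≡⟨ cong (λ i → ι i * (f j * g (n ℕ.∸ j))) (ℕP.m∸n+n≡m j≤n) ⟨
    ι (n ℕ.∸ j ℕ.+ j) * (f j * g (n ℕ.∸ j))        ≡⟨ cong (_* (f j * g (n ℕ.∸ j))) (ι-+ (n ℕ.∸ j) j) ⟩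
    (ι (n ℕ.∸ j) + ι j) * (f j * g (n ℕ.∸ j))      ≡⟨ solve 4 (λ a b x y → (a :+ b) :* (x :* y) := b :* x :* y :+ x :* (a :* y))
                                                              refl (ι (n ℕ.∸ j)) (ι j) (f j) (g (n ℕ.∸ j)) ⟩
    ι j * f j * g (n ℕ.∸ j) + f j * (ι (n ℕ.∸ j) * g (n ℕ.∸ j)) ∎

δ-⋆ : ∀ f g → δ (f ⋆ g) ≗ δ f ⋆ g ⊕ f ⋆ δ g
δ-⋆ f g n = begin
  θ (f ⋆ g) n - (z· θ (f ⋆ g)) n          ≡⟨ cong₂ _-_ (θ-⋆ f g n) (trans (z·-cong (θ-⋆ f g) n) (z·-⊕ A B n)) ⟩
  (A n + B n) - ((z· A) n + (z· B) n)     ≡⟨ solve 4 (λ a b c d → a :+ b :- (c :+ d) := a :- c :+ (b :- d)) refl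
                                                     (A n) (B n) ((z· A) n) ((z· B) n) ⟩
  (A n - (z· A) n) + (B n - (z· B) n)     ≡⟨ cong₂ _+_ δf⋆g f⋆δg ⟨
  (δ f ⋆ g) n + (f ⋆ δ g) n               ∎
  where
  open ≡-Reasoning
  A = θ f ⋆ g
  B = f ⋆ θ g
  δf⋆g : (δ f ⋆ g) n ≡ A n - (z· A) n
  δf⋆g = trans (⋆-distribʳ-⊖ (θ f) (z· θ f) g n) (cong (λ x → A n - x) (z·-⋆ (θ f) g n))
  f⋆δg : (f ⋆ δ g) n ≡ B n - (z· B) n
  f⋆δg = trans (⋆-distribˡ-⊖ f (θ g) (z· θ g) n) (cong (λ x → B n - x) (⋆-z· f (θ g) n))

θ-oneS : θ oneS ≗ zeroS
θ-oneS zero    = refl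
θ-oneS (suc n) = ℚP.*-zeroʳ (ι (suc n))

δ-oneS : δ oneS ≗ zeroS
δ-oneS zero    = refl
δ-oneS (suc n) = cong₂ _-_ (θ-oneS (suc n)) (θ-oneS n)

signPow-* : ∀ m x → signPow m x ≡ signPow m 1ℚ * x
signPow-* zero    x = sym (ℚP.*-identityˡ x)
signPow-* (suc m) x = trans (cong -_ (signPow-* m x)) (ℚP.neg-distribˡ-* (signPow m 1ℚ) x)

module _ (α : ℚ) where

  oneMinusZPow-rec : ∀ m → ι (suc m) * oneMinusZPow α (suc m) ≡ (ι m - α) * oneMinusZPow α m
  oneMinusZPow-rec m = begin
    ι (suc m) * - signPow m Q      ≡⟨ cong (λ x → ι (suc m) * - x) (signPow-* m Q) ⟩
    ι (suc m) * - (s * Q)          ≡⟨ solve 3 (λ i s q → i :* (:- (s :* q)) := (:- s) :* (i :* q)) refl (ι (suc m)) s Q ⟩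
    (- s) * (ι (suc m) * Q)        ≡⟨ cong ((- s) *_) (q*[p÷′q]≡p (B * (α - ι m)) (ι (suc m)) (ι-suc≢0 m)) ⟩
    (- s) * (B * (α - ι m))        ≡⟨ solve 4 (λ s b a i → (:- s) :* (b :* (a :- i)) := (i :- a) :* (s :* b)) refl s B α (ι m) ⟩
    (ι m - α) * (s * B)            ≡⟨ cong ((ι m - α) *_) (signPow-* m B) ⟨
    (ι m - α) * oneMinusZPow α m   ∎
    where
    open ≡-Reasoning
    s = signPow m 1ℚ
    B = binomQ α m
    Q = (B * (α - ι m)) ÷′ ι (suc m)

  δ-Φ : δ (Φ α) ≗ α ⊙ z· (oneS ⊖ Φ α)
  δ-Φ zero    = solve 2 (λ x a → con 0ℚ :* x :- con 0ℚ := a :* con 0ℚ) refl (Φ α 0) α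
  δ-Φ (suc m) = begin
    ι (suc m) * (0ℚ - g (suc m)) - ι m * (oneS m - g m)
      ≡⟨ solve 5 (λ s g′ i o h → s :* (con 0ℚ :- g′) :- i :* (o :- h) := :- (s :* g′) :- i :* o :+ i :* h)
               refl (ι (suc m)) (g (suc m)) (ι m) (oneS m) (g m) ⟩
    - (ι (suc m) * g (suc m)) - ι m * oneS m + ι m * g m
      ≡⟨ cong₂ (λ u v → - u - v + ι m * g m) (oneMinusZPow-rec m) (θ-oneS m) ⟩
    - ((ι m - α) * g m) - 0ℚ + ι m * g m
      ≡⟨ solve 4 (λ i a h o → :- ((i :- a) :* h) :- con 0ℚ :+ i :* h := a :* (o :- (o :- h)))
               refl (ι m) α (g m) (oneS m) ⟩
    α * (oneS m - (oneS m - g m))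
      ∎
    where
    open ≡-Reasoning
    g = oneMinusZPow α

  δ-Φ^S : ∀ k → δ (Φ α ^S suc k) ≗ (ι (suc k) * α) ⊙ z· (Φ α ^S k ⊖ Φ α ^S suc k)
  Φ⋆δ-Φ^S : ∀ k → Φ α ⋆ δ (Φ α ^S k) ≗ (ι k * α) ⊙ z· (Φ α ^S k ⊖ Φ α ^S suc k)

  δ-Φ^S k = begin
    δ (Φ α ⋆ (Φ α ^S k))                        ≈⟨ δ-⋆ (Φ α) (Φ α ^S k) ⟩
    δ (Φ α) ⋆ (Φ α ^S k) ⊕ Φ α ⋆ δ (Φ α ^S k)   ≈⟨ ⊕-cong δΦ⋆Φ^S (Φ⋆δ-Φ^S k) ⟩
    α ⊙ X ⊕ (ι k * α) ⊙ X                       ≈⟨ collect ⟩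
    (ι (suc k) * α) ⊙ X                         ∎
    where
    open ≗-Reasoning
    X = z· (Φ α ^S k ⊖ Φ α ^S suc k)
    δΦ⋆Φ^S : δ (Φ α) ⋆ (Φ α ^S k) ≗ α ⊙ X
    δΦ⋆Φ^S = begin
      δ (Φ α) ⋆ (Φ α ^S k)                        ≈⟨ ⋆-cong δ-Φ (λ _ → refl) ⟩
      (α ⊙ z· (oneS ⊖ Φ α)) ⋆ (Φ α ^S k)          ≈⟨ ⊙-⋆ α _ (Φ α ^S k) ⟩
      α ⊙ ((z· (oneS ⊖ Φ α)) ⋆ (Φ α ^S k))        ≈⟨ ⊙-cong α (z·-⋆ (oneS ⊖ Φ α) (Φ α ^S k)) ⟩
      α ⊙ z· ((oneS ⊖ Φ α) ⋆ (Φ α ^S k))          ≈⟨ ⊙-cong α (z·-cong (⋆-distribʳ-⊖ oneS (Φ α) (Φ α ^S k))) ⟩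
      α ⊙ z· (oneS ⋆ (Φ α ^S k) ⊖ Φ α ^S suc k)   ≈⟨ ⊙-cong α (z·-cong (⊖-cong (⋆-identityˡ (Φ α ^S k)) (λ _ → refl))) ⟩
      α ⊙ X                                       ∎
    collect : α ⊙ X ⊕ (ι k * α) ⊙ X ≗ (ι (suc k) * α) ⊙ X
    collect n = trans (solve 3 (λ a i x → a :* x :+ i :* a :* x := (con 1ℚ :+ i) :* a :* x) refl α (ι k) (X n))
                      (cong (λ c → c * α * X n) (sym (ι-suc k)))

  Φ⋆δ-Φ^S zero = begin
    Φ α ⋆ δ oneS                       ≈⟨ ⋆-cong (λ _ → refl) δ-oneS ⟩
    Φ α ⋆ zeroS                        ≈⟨ ⋆-zeroʳ (Φ α) ⟩
    zeroS                              ≈⟨ (λ n → solve 2 (λ a x → con 0ℚ :* a :* x := con 0ℚ) refl α _) ⟨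
    (ι 0 * α) ⊙ z· (oneS ⊖ Φ α ^S 1)   ∎
    where open ≗-Reasoning
  Φ⋆δ-Φ^S (suc k) = begin
    Φ α ⋆ δ (Φ α ^S suc k)                       ≈⟨ ⋆-cong (λ _ → refl) (δ-Φ^S k) ⟩
    Φ α ⋆ (c ⊙ z· Y)                             ≈⟨ ⋆-⊙ c (Φ α) (z· Y) ⟩
    c ⊙ (Φ α ⋆ z· Y)                             ≈⟨ ⊙-cong c (⋆-z· (Φ α) Y) ⟩
    c ⊙ z· (Φ α ⋆ Y)                             ≈⟨ ⊙-cong c (z·-cong (⋆-distribˡ-⊖ (Φ α) (Φ α ^S k) (Φ α ^S suc k))) ⟩
    c ⊙ z· (Φ α ^S suc k ⊖ Φ α ^S suc (suc k))   ∎
    where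
    open ≗-Reasoning
    c = ι (suc k) * α
    Y = Φ α ^S k ⊖ Φ α ^S suc k

  Φ^S-coeff-rec : ∀ k n → ι (suc n) * (Φ α ^S suc k) (suc n)
                          ≡ ι (suc k) * α * (Φ α ^S k) n + (ι n - ι (suc k) * α) * (Φ α ^S suc k) n
  Φ^S-coeff-rec k n = begin
    ι (suc n) * F′ (suc n)                               ≡⟨ solve 2 (λ x y → x := x :- y :+ y) refl (ι (suc n) * F′ (suc n)) (ι n * F′ n) ⟩
    (ι (suc n) * F′ (suc n) - ι n * F′ n) + ι n * F′ n   ≡⟨ cong (_+ ι n * F′ n) (δ-Φ^S k (suc n)) ⟩
    c * (F n - F′ n) + ι n * F′ n                        ≡⟨ solve 4 (λ c a b i → c :* (a :- b) :+ i :* b := c :* a :+ (i :- c) :* b)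
                                                                   refl c (F n) (F′ n) (ι n) ⟩
    c * F n + (ι n - c) * F′ n                           ∎
    where
    open ≡-Reasoning
    F  = Φ α ^S k
    F′ = Φ α ^S suc k
    c  = ι (suc k) * α

  𝒞-rec : ∀ n k → 𝒞 α (suc n) (suc k) ≡ ι (suc k) * α * 𝒞 α n k + (ι n - ι (suc k) * α) * 𝒞 α n (suc k)
  𝒞-rec n k = begin
    ι (suc n ℕ.* n !) * F′ (suc n)            ≡⟨ cong (_* F′ (suc n)) (ι-* (suc n) (n !)) ⟩
    ι (suc n) * ι (n !) * F′ (suc n)          ≡⟨ solve 3 (λ s f x → s :* f :* x := f :* (s :* x)) refl (ι (suc n)) (ι (n !)) (F′ (suc n)) ⟩
    ι (n !) * (ι (suc n) * F′ (suc n))        ≡⟨ cong (ι (n !) *_) (Φ^S-coeff-rec k n) ⟩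
    ι (n !) * (c * F n + (ι n - c) * F′ n)    ≡⟨ solve 5 (λ f c a i b → f :* (c :* a :+ (i :- c) :* b) := c :* (f :* a) :+ (i :- c) :* (f :* b))
                                                       refl (ι (n !)) c (F n) (ι n) (F′ n) ⟩
    c * 𝒞 α n k + (ι n - c) * 𝒞 α n (suc k)   ∎
    where
    open ≡-Reasoning
    F  = Φ α ^S k
    F′ = Φ α ^S suc k
    c  = ι (suc k) * α

  𝒞-vanishes : ∀ n k → n ℕ.< k → 𝒞 α n k ≡ 0ℚ
  𝒞-vanishes zero    (suc k) _          = trans (cong (ι 1 *_) (ℚP.*-zeroˡ ((Φ α ^S k) 0))) (ℚP.*-zeroʳ (ι 1))
  𝒞-vanishes (suc n) (suc k) (s≤s n<k) = begin
    𝒞 α (suc n) (suc k)                       ≡⟨ 𝒞-rec n k ⟩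
    c * 𝒞 α n k + (ι n - c) * 𝒞 α n (suc k)   ≡⟨ cong₂ (λ x y → c * x + (ι n - c) * y)
                                                       (𝒞-vanishes n k n<k) (𝒞-vanishes n (suc k) (ℕP.m<n⇒m<1+n n<k)) ⟩
    c * 0ℚ + (ι n - c) * 0ℚ                   ≡⟨ solve 2 (λ c d → c :* con 0ℚ :+ d :* con 0ℚ := con 0ℚ) refl c (ι n - c) ⟩
    0ℚ                                        ∎
    where
    open ≡-Reasoning
    c = ι (suc k) * α

  probK-0 : ∀ n → probK α (suc n) 0 ≡ 0ℚ
  probK-0 n = trans (cong (_÷′ rising α (suc n)) (ℚP.*-zeroʳ (ι (suc n !)))) (0÷′q≡0 (rising α (suc n)))

  probK-vanishes : ∀ n k → n ℕ.< k → probK α n k ≡ 0ℚ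
  probK-vanishes n k n<k = trans (cong (_÷′ rising α n) (𝒞-vanishes n k n<k)) (0÷′q≡0 (rising α n))

module _ {α : ℚ} (0<α : 0ℚ < α) where

  α+ι≢0 : ∀ n → α + ι n ≢ 0ℚ
  α+ι≢0 n α+n≡0 = ℚP.<⇒≢ (ℚP.+-mono-<-≤ 0<α (ι-nonNeg n)) (sym α+n≡0)

  rising≢0 : ∀ n → rising α n ≢ 0ℚ
  rising≢0 zero    = ℚP.1≢0
  rising≢0 (suc n) = *-≢0 (rising α n) (α + ι n) (rising≢0 n) (α+ι≢0 n)

  probK-rec : ∀ n k → probK α (suc n) (suc k)
                      ≡ upProb α n k * probK α n k + stayProb α n (suc k) * probK α n (suc k)
  probK-rec n k = trans (cong (_÷′ (rising α n * (α + ι n))) (𝒞-rec α n k))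
    (÷′-distrib-*+* (ι (suc k) * α) (ι n - ι (suc k) * α) (𝒞 α n k) (𝒞 α n (suc k))
                    (rising α n) (α + ι n) (rising≢0 n) (α+ι≢0 n))

  probK-1-1 : probK α 1 1 ≡ 1ℚ
  probK-1-1 = q*x≡p⇒p÷′q≡x (𝒞 α 1 1) (rising α 1) 1ℚ (rising≢0 1) (begin
    rising α 1 * 1ℚ
      ≡⟨ solve 1 (λ a → con 1ℚ :* (a :+ con 0ℚ) :* con 1ℚ
                        := con 1ℚ :* a :* (con 1ℚ :* con 1ℚ) :+ (con 0ℚ :- con 1ℚ :* a) :* con 0ℚ) refl α ⟩
    ι 1 * α * 𝒞 α 0 0 + (ι 0 - ι 1 * α) * 0ℚ
      ≡⟨ cong (λ x → ι 1 * α * 𝒞 α 0 0 + (ι 0 - ι 1 * α) * x) (𝒞-vanishes α 0 1 (s≤s z≤n)) ⟨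
    ι 1 * α * 𝒞 α 0 0 + (ι 0 - ι 1 * α) * 𝒞 α 0 1
      ≡⟨ 𝒞-rec α 0 0 ⟨
    𝒞 α 1 1
      ∎)
    where open ≡-Reasoning

  probK≡chainLaw : ∀ n k → probK α (suc n) k ≡ chainLaw α (suc n) k
  probK≡chainLaw zero    zero          = probK-0 α 0
  probK≡chainLaw zero    (suc zero)    = probK-1-1
  probK≡chainLaw zero    (suc (suc k)) = probK-vanishes α 1 (suc (suc k)) (s≤s (s≤s z≤n))
  probK≡chainLaw (suc n) zero          = begin
    probK α (suc (suc n)) 0                       ≡⟨ probK-0 α (suc n) ⟩
    0ℚ                                            ≡⟨ ℚP.*-zeroʳ (stayProb α (suc n) 0) ⟨
    stayProb α (suc n) 0 * 0ℚ                     ≡⟨ cong (stayProb α (suc n) 0 *_) (trans (sym (probK-0 α n)) (probK≡chainLaw n 0)) ⟩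
    stayProb α (suc n) 0 * chainLaw α (suc n) 0   ∎
    where open ≡-Reasoning
  probK≡chainLaw (suc n) (suc k)       = trans (probK-rec (suc n) k)
    (cong₂ (λ x y → upProb α (suc n) k * x + stayProb α (suc n) (suc k) * y)
           (probK≡chainLaw n k) (probK≡chainLaw n (suc k)))

mainTheorem3 : (α : ℚ) → 0ℚ < α → α < 1ℚ →
    ((n k : ℕ) → 1 ℕ.≤ n → 1 ℕ.≤ k → k ℕ.≤ suc n →
      probK α (suc n) k
        ≡ ((ι k * α) ÷′ (α + ι n)) * probK α n (k ℕ.∸ 1)
          + ((ι n - ι k * α) ÷′ (α + ι n)) * probK α n k)
    × probK α 1 1 ≡ 1ℚ
    × ((n : ℕ) → 1 ℕ.≤ n → probK α n 0 ≡ 0ℚ × probK α n (suc n) ≡ 0ℚ)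
    × ((n k : ℕ) → 1 ℕ.≤ n → probK α n k ≡ chainLaw α n k)
mainTheorem3 α 0<α _ =
    (λ { n (suc k) _ _ _ → probK-rec 0<α n k })
  , probK-1-1 0<α
  , (λ { (suc n) _ → probK-0 α n , probK-vanishes α (suc n) (suc (suc n)) ℕP.≤-refl })
  , (λ { (suc n) k _ → probK≡chainLaw 0<α n k })
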